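{- Let $t,u$ be vsub$_k$-terms. (1) If $t\to_{\mathtt m}u$ then $t^{\circ}\to_{\bar\lambda}u^{\circ}$. (2) If $t\to_{\mathtt e}u$ then $t^{\circ}\to_{\tilde\mu}u^{\circ}$.
   Context: Vsub$_k$-terms: $t,u::= v\mid tv\mid t[x\leftarrow u]$, values $v::=x\mid\lambda x.t$, where $t[x\leftarrow u]$ binds $x$ in $t$; up to $\alpha$; $t\{x\leftarrow v\}$ capture-avoiding substitution. Evaluation contexts $E::=\langle\cdot\rangle\mid Ev\mid E[x\leftarrow u]\mid t[x\leftarrow E]$; substitution contexts $L::=\langle\cdot\rangle\mid L[x\leftarrow u]$. $\to_{\mathtt m}$ is the closure under evaluation contexts of $L\langle\lambda x.t\rangle v\mapsto L\langle t[x\leftarrow v]\rangle$ and $\to_{\mathtt e}$ that of $t[x\leftarrow L\langle v\rangle]\mapsto L\langle t\{x\leftarrow v\}\rangle$ (bound variables of $L$ not free in the other subterm). Value sequent calculus: commands $c::=\langle v\mid e\rangle$; values $v::=x\mid\lambda x.c$; environments $e::=\epsilon\mid\tilde\mu x.c\mid v\cdot e$ ($\lambda x.c$, $\tilde\mu x.c$ bind $x$). Append: $\langle v\mid e'\rangle@e=\langle v\mid e'@e\rangle$; $\epsilon@e=e$; $(v\cdot e')@e=v\cdot(e'@e)$; $(\tilde\mu x.c)@e=\tilde\mu y.(c\{x\leftarrow y\}@e)$, $y$ fresh. Contexts $C::=\langle\cdot\rangle\mid D\langle\tilde\mu x.C\rangle$, $D::=\langle v\mid\langle\cdot\rangle\rangle\mid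 D\langle v\cdot\langle\cdot\rangle\rangle$. $\to_{\bar\lambda}$, $\to_{\tilde\mu}$ are the closures under contexts $C$ of $\langle\lambda x.c\mid v\cdot e\rangle\mapsto\langle v\mid(\tilde\mu x.c)@e\rangle$ and $\langle v\mid\tilde\mu x.c\rangle\mapsto c\{x\leftarrow v\}$. Translation: $x^{\bullet}=x$, $(\lambda x.t)^{\bullet}=\lambda x.t^{\circ}$; $v^{\circ}=\langle v^{\bullet}\mid\epsilon\rangle$, $(tv)^{\circ}=t^{\circ}@(v^{\bullet}\cdot\epsilon)$, $(t[x\leftarrow u])^{\circ}=u^{\circ}@(\tilde\mu x.t^{\circ})$. -}

module Defs where

open import Data.Nat using (ℕ; zero; suc)
open import Data.Fin using (Fin; zero; suc)

-- Well-scoped de Bruijn syntax (terms up to α-equivalence).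
-- A term of type `Term n` has its free variables among `Fin n`;
-- variable `zero` is the most recently bound one.

mutual
  data Val (n : ℕ) : Set where
    var : Fin n → Val n
    lam : Term (suc n) → Val n

  data Term (n : ℕ) : Set where
    val  : Val n → Term n
    app  : Term n → Val n → Term n
    esub : Term (suc n) → Term n → Term n

Ren : ℕ → ℕ → Set
Ren n m = Fin n → Fin m

ext : ∀ {n m} → Ren n m → Ren (suc n) (suc m)
ext ρ zero    = zero
ext ρ (suc i) = suc (ρ i)

mutual
  renV : ∀ {n m} → Ren n m → Val n → Val m
  renV ρ (var i) = var (ρ i)
  renV ρ (lam t) = lam (renT (ext ρ) t)

  renT : ∀ {n m} → Ren n m → Term n → Term m
  renT ρ (val v)    = val (renV ρ v)
  renT ρ (app t v)  = app (renT ρ t) (renV ρ v)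
  renT ρ (esub t u) = esub (renT (ext ρ) t) (renT ρ u)

Sub : ℕ → ℕ → Set
Sub n m = Fin n → Val m

exts : ∀ {n m} → Sub n m → Sub (suc n) (suc m)
exts σ zero    = var zero
exts σ (suc i) = renV suc (σ i)

mutual
  subV : ∀ {n m} → Sub n m → Val n → Val m
  subV σ (var i) = σ i
  subV σ (lam t) = lam (subT (exts σ) t)

  subT : ∀ {n m} → Sub n m → Term n → Term m
  subT σ (val v)    = val (subV σ v)
  subT σ (app t v)  = app (subT σ t) (subV σ v)
  subT σ (esub t u) = esub (subT (exts σ) t) (subT σ u)

single : ∀ {n} → Val n → Sub (suc n) n
single v zero    = v
single v (suc i) = var i

_⟪_⟫ : ∀ {n} → Term (suc n) → Val n → Term n
t ⟪ v ⟫ = subT (single v) t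

-- substitution contexts  L ::= ⟨·⟩ | L[x←u]
-- `SCtx n m`: the plugged term lives in scope n, the hole in scope m.
data SCtx (n : ℕ) : ℕ → Set where
  hole : SCtx n n
  sub  : ∀ {m} → SCtx (suc n) m → Term n → SCtx n m

plugL : ∀ {n m} → SCtx n m → Term m → Term n
plugL hole      t = t
plugL (sub L u) t = esub (plugL L t) u

-- weakening of the outer scope past the variables bound by L
-- (this realises the side condition "bound variables of L are not
-- free in the other subterm")
wkL : ∀ {n m} → SCtx n m → Ren n m
wkL hole      i = i
wkL (sub L u) i = wkL L (suc i)

data _↦m_ {n : ℕ} : Term n → Term n → Set where
  root-m : ∀ {m} (L : SCtx n m) (t : Term (suc m)) (v : Val n) →
           app (plugL L (val (lam t))) v ↦m plugL L (esub t (val (renV (wkL L) v)))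

data _↦e_ {n : ℕ} : Term n → Term n → Set where
  root-e : ∀ {m} (L : SCtx n m) (t : Term (suc n)) (v : Val m) →
           esub t (plugL L (val v)) ↦e plugL L ((renT (ext (wkL L)) t) ⟪ v ⟫)

data EClos (R : ∀ {n} → Term n → Term n → Set) : ∀ {n} → Term n → Term n → Set where
  ctx-hole : ∀ {n} {t u : Term n} → R t u → EClos R t u
  ctx-app  : ∀ {n} {t u : Term n} (v : Val n) → EClos R t u → EClos R (app t v) (app u v)
  ctx-esL  : ∀ {n} {t u : Term (suc n)} (s : Term n) → EClos R t u → EClos R (esub t s) (esub u s)
  ctx-esR  : ∀ {n} {t u : Term n} (s : Term (suc n)) → EClos R t u → EClos R (esub s t) (esub s u)

_→m_ : ∀ {n} → Term n → Term n → Set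
_→m_ = EClos _↦m_

_→e_ : ∀ {n} → Term n → Term n → Set
_→e_ = EClos _↦e_

mutual
  data SVal (n : ℕ) : Set where
    svar : Fin n → SVal n
    slam : Cmd (suc n) → SVal n

  data Env (n : ℕ) : Set where
    ε    : Env n
    μ̃    : Cmd (suc n) → Env n
    _∷ₑ_ : SVal n → Env n → Env n

  data Cmd (n : ℕ) : Set where
    ⟨_∣_⟩ : SVal n → Env n → Cmd n

infixr 5 _∷ₑ_
infixr 4 _++C_ _++E_
infix 30 _• _°

mutual
  renSV : ∀ {n m} → Ren n m → SVal n → SVal m
  renSV ρ (svar i) = svar (ρ i)
  renSV ρ (slam c) = slam (renC (ext ρ) c)

  renE : ∀ {n m} → Ren n m → Env n → Env m
  renE ρ ε        = ε
  renE ρ (μ̃ c)    = μ̃ (renC (ext ρ) c)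
  renE ρ (v ∷ₑ e) = renSV ρ v ∷ₑ renE ρ e

  renC : ∀ {n m} → Ren n m → Cmd n → Cmd m
  renC ρ ⟨ v ∣ e ⟩ = ⟨ renSV ρ v ∣ renE ρ e ⟩

SSub : ℕ → ℕ → Set
SSub n m = Fin n → SVal m

sexts : ∀ {n m} → SSub n m → SSub (suc n) (suc m)
sexts σ zero    = svar zero
sexts σ (suc i) = renSV suc (σ i)

mutual
  subSV : ∀ {n m} → SSub n m → SVal n → SVal m
  subSV σ (svar i) = σ i
  subSV σ (slam c) = slam (subC (sexts σ) c)

  subE : ∀ {n m} → SSub n m → Env n → Env m
  subE σ ε        = ε
  subE σ (μ̃ c)    = μ̃ (subC (sexts σ) c)
  subE σ (v ∷ₑ e) = subSV σ v ∷ₑ subE σ e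

  subC : ∀ {n m} → SSub n m → Cmd n → Cmd m
  subC σ ⟨ v ∣ e ⟩ = ⟨ subSV σ v ∣ subE σ e ⟩

ssingle : ∀ {n} → SVal n → SSub (suc n) n
ssingle v zero    = v
ssingle v (suc i) = svar i

_⟦_⟧ : ∀ {n} → Cmd (suc n) → SVal n → Cmd n
c ⟦ v ⟧ = subC (ssingle v) c

-- append  (μ̃x.c)@e = μ̃y.(c{x←y}@e), y fresh: in de Bruijn, e is
-- weakened under the binder.
mutual
  _++C_ : ∀ {n} → Cmd n → Env n → Cmd n
  ⟨ v ∣ e′ ⟩ ++C e = ⟨ v ∣ e′ ++E e ⟩

  _++E_ : ∀ {n} → Env n → Env n → Env n
  ε         ++E e = e
  (v ∷ₑ e′) ++E e = v ∷ₑ (e′ ++E e)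
  (μ̃ c)     ++E e = μ̃ (c ++C renE suc e)

data _↦λ̄_ {n : ℕ} : Cmd n → Cmd n → Set where
  root-λ̄ : (c : Cmd (suc n)) (v : SVal n) (e : Env n) →
           ⟨ slam c ∣ v ∷ₑ e ⟩ ↦λ̄ ⟨ v ∣ (μ̃ c) ++E e ⟩

data _↦μ̃_ {n : ℕ} : Cmd n → Cmd n → Set where
  root-μ̃ : (v : SVal n) (c : Cmd (suc n)) → ⟨ v ∣ μ̃ c ⟩ ↦μ̃ (c ⟦ v ⟧)

data DCtx (n : ℕ) : Set where
  dhole : SVal n → DCtx n
  dcons : DCtx n → SVal n → DCtx n

plugD : ∀ {n} → DCtx n → Env n → Cmd n
plugD (dhole v)   e = ⟨ v ∣ e ⟩
plugD (dcons D v) e = plugD D (v ∷ₑ e)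

data CClos (R : ∀ {n} → Cmd n → Cmd n → Set) : ∀ {n} → Cmd n → Cmd n → Set where
  cctx-hole : ∀ {n} {c c′ : Cmd n} → R c c′ → CClos R c c′
  cctx-μ̃    : ∀ {n} {c c′ : Cmd (suc n)} (D : DCtx n) →
              CClos R c c′ → CClos R (plugD D (μ̃ c)) (plugD D (μ̃ c′))

_→λ̄_ : ∀ {n} → Cmd n → Cmd n → Set
_→λ̄_ = CClos _↦λ̄_

_→μ̃_ : ∀ {n} → Cmd n → Cmd n → Set
_→μ̃_ = CClos _↦μ̃_

mutual
  _• : ∀ {n} → Val n → SVal n
  var x • = svar x
  lam t • = slam (t °)

  _° : ∀ {n} → Term n → Cmd n
  val v °    = ⟨ v • ∣ ε ⟩
  app t v °  = (t °) ++C ((v •) ∷ₑ ε)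
  esub t u ° = (u °) ++C μ̃ (t °)

-- The translation is compositional up to append: t v and t[x←u] are sent to
-- t° @ (v•·ε) and u° @ μ̃x.t°, and a substitution context L becomes the
-- command context L° = u₁° @ μ̃x₁.(… uₖ° @ μ̃xₖ.⟨·⟩).  Appending to a command
-- only extends its environment, so a hole inside u° @ μ̃x.⟨·⟩ sits in a
-- context D⟨μ̃y.C⟩ (recursing into the μ̃-bodies of u°'s environment).  As
-- appending under a binder weakens its argument, root steps that are stable
-- under renaming and under _@ e give reductions closed under _@ e and
-- u° @ μ̃x.⟨·⟩, so every evaluation context is mapped to a reduction context.
-- At the root, L⟨λx.t⟩v is sent to L°⟨⟨λx.t° | v•·ε⟩⟩, which λ̄-reduces to
-- L°⟨⟨v• | μ̃x.t°⟩⟩ = (L⟨t[x←v]⟩)°, and t[x←L⟨v⟩] is sent to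
-- L°⟨⟨v• | μ̃x.t°⟩⟩, which μ̃-reduces to L°⟨t°{x←v•}⟩ = (L⟨t{x←v}⟩)° because
-- the translation commutes with substitution.
module Submission where

open import Defs
open import Data.Product using (_×_; _,_)
open import Data.Nat using (suc)
open import Data.Fin using (zero; suc)
open import Function using (_∘_; id)
open import Relation.Binary.PropositionalEquality
open ≡-Reasoning

mutual
  renSV-renSV : ∀ {n m k} {ρ : Ren m k} {σ : Ren n m} {τ : Ren n k} →
                ρ ∘ σ ≗ τ → ∀ v → renSV ρ (renSV σ v) ≡ renSV τ v
  renSV-renSV h (svar i) = cong svar (h i)
  renSV-renSV h (slam c) = cong slam (renC-renC (ext-ext h) c)

  renE-renE : ∀ {n m k} {ρ : Ren m k} {σ : Ren n m} {τ : Ren n k} →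
              ρ ∘ σ ≗ τ → ∀ e → renE ρ (renE σ e) ≡ renE τ e
  renE-renE h ε        = refl
  renE-renE h (μ̃ c)    = cong μ̃ (renC-renC (ext-ext h) c)
  renE-renE h (v ∷ₑ e) = cong₂ _∷ₑ_ (renSV-renSV h v) (renE-renE h e)

  renC-renC : ∀ {n m k} {ρ : Ren m k} {σ : Ren n m} {τ : Ren n k} →
              ρ ∘ σ ≗ τ → ∀ c → renC ρ (renC σ c) ≡ renC τ c
  renC-renC h ⟨ v ∣ e ⟩ = cong₂ ⟨_∣_⟩ (renSV-renSV h v) (renE-renE h e)

  ext-ext : ∀ {n m k} {ρ : Ren m k} {σ : Ren n m} {τ : Ren n k} →
            ρ ∘ σ ≗ τ → ext ρ ∘ ext σ ≗ ext τ
  ext-ext h zero    = refl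
  ext-ext h (suc i) = cong suc (h i)

mutual
  subSV-renSV : ∀ {n m k} {σ : SSub m k} {ρ : Ren n m} {τ : SSub n k} →
                σ ∘ ρ ≗ τ → ∀ v → subSV σ (renSV ρ v) ≡ subSV τ v
  subSV-renSV h (svar i) = h i
  subSV-renSV h (slam c) = cong slam (subC-renC (sexts-ext h) c)

  subE-renE : ∀ {n m k} {σ : SSub m k} {ρ : Ren n m} {τ : SSub n k} →
              σ ∘ ρ ≗ τ → ∀ e → subE σ (renE ρ e) ≡ subE τ e
  subE-renE h ε        = refl
  subE-renE h (μ̃ c)    = cong μ̃ (subC-renC (sexts-ext h) c)
  subE-renE h (v ∷ₑ e) = cong₂ _∷ₑ_ (subSV-renSV h v) (subE-renE h e)

  subC-renC : ∀ {n m k} {σ : SSub m k} {ρ : Ren n m} {τ : SSub n k} →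
              σ ∘ ρ ≗ τ → ∀ c → subC σ (renC ρ c) ≡ subC τ c
  subC-renC h ⟨ v ∣ e ⟩ = cong₂ ⟨_∣_⟩ (subSV-renSV h v) (subE-renE h e)

  sexts-ext : ∀ {n m k} {σ : SSub m k} {ρ : Ren n m} {τ : SSub n k} →
              σ ∘ ρ ≗ τ → sexts σ ∘ ext ρ ≗ sexts τ
  sexts-ext h zero    = refl
  sexts-ext h (suc i) = cong (renSV suc) (h i)

mutual
  renSV-subSV : ∀ {n m k} {ρ : Ren m k} {σ : SSub n m} {τ : SSub n k} →
                renSV ρ ∘ σ ≗ τ → ∀ v → renSV ρ (subSV σ v) ≡ subSV τ v
  renSV-subSV h (svar i) = h i
  renSV-subSV h (slam c) = cong slam (renC-subC (ext-sexts h) c)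

  renE-subE : ∀ {n m k} {ρ : Ren m k} {σ : SSub n m} {τ : SSub n k} →
              renSV ρ ∘ σ ≗ τ → ∀ e → renE ρ (subE σ e) ≡ subE τ e
  renE-subE h ε        = refl
  renE-subE h (μ̃ c)    = cong μ̃ (renC-subC (ext-sexts h) c)
  renE-subE h (v ∷ₑ e) = cong₂ _∷ₑ_ (renSV-subSV h v) (renE-subE h e)

  renC-subC : ∀ {n m k} {ρ : Ren m k} {σ : SSub n m} {τ : SSub n k} →
              renSV ρ ∘ σ ≗ τ → ∀ c → renC ρ (subC σ c) ≡ subC τ c
  renC-subC h ⟨ v ∣ e ⟩ = cong₂ ⟨_∣_⟩ (renSV-subSV h v) (renE-subE h e)

  ext-sexts : ∀ {n m k} {ρ : Ren m k} {σ : SSub n m} {τ : SSub n k} →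
              renSV ρ ∘ σ ≗ τ → renSV (ext ρ) ∘ sexts σ ≗ sexts τ
  ext-sexts h zero             = refl
  ext-sexts {ρ = ρ} {σ} {τ} h (suc i) = begin
    renSV (ext ρ) (renSV suc (σ i))  ≡⟨ renSV-renSV (λ _ → refl) (σ i) ⟩
    renSV (suc ∘ ρ) (σ i)            ≡⟨ renSV-renSV (λ _ → refl) (σ i) ⟨
    renSV suc (renSV ρ (σ i))        ≡⟨ cong (renSV suc) (h i) ⟩
    renSV suc (τ i)                  ∎

mutual
  renSV-id : ∀ {n} {ρ : Ren n n} → ρ ≗ id → ∀ v → renSV ρ v ≡ v
  renSV-id h (svar i) = cong svar (h i)
  renSV-id h (slam c) = cong slam (renC-id (ext-id h) c)

  renE-id : ∀ {n} {ρ : Ren n n} → ρ ≗ id → ∀ e → renE ρ e ≡ e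
  renE-id h ε        = refl
  renE-id h (μ̃ c)    = cong μ̃ (renC-id (ext-id h) c)
  renE-id h (v ∷ₑ e) = cong₂ _∷ₑ_ (renSV-id h v) (renE-id h e)

  renC-id : ∀ {n} {ρ : Ren n n} → ρ ≗ id → ∀ c → renC ρ c ≡ c
  renC-id h ⟨ v ∣ e ⟩ = cong₂ ⟨_∣_⟩ (renSV-id h v) (renE-id h e)

  ext-id : ∀ {n} {ρ : Ren n n} → ρ ≗ id → ext ρ ≗ id
  ext-id h zero    = refl
  ext-id h (suc i) = cong suc (h i)

mutual
  subSV-id : ∀ {n} {σ : SSub n n} → σ ≗ svar → ∀ v → subSV σ v ≡ v
  subSV-id h (svar i) = h i
  subSV-id h (slam c) = cong slam (subC-id (sexts-id h) c)

  subE-id : ∀ {n} {σ : SSub n n} → σ ≗ svar → ∀ e → subE σ e ≡ e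
  subE-id h ε        = refl
  subE-id h (μ̃ c)    = cong μ̃ (subC-id (sexts-id h) c)
  subE-id h (v ∷ₑ e) = cong₂ _∷ₑ_ (subSV-id h v) (subE-id h e)

  subC-id : ∀ {n} {σ : SSub n n} → σ ≗ svar → ∀ c → subC σ c ≡ c
  subC-id h ⟨ v ∣ e ⟩ = cong₂ ⟨_∣_⟩ (subSV-id h v) (subE-id h e)

  sexts-id : ∀ {n} {σ : SSub n n} → σ ≗ svar → sexts σ ≗ svar
  sexts-id h zero    = refl
  sexts-id h (suc i) = cong (renSV suc) (h i)

renE-ext-weaken : ∀ {n m} (ρ : Ren n m) e → renE (ext ρ) (renE suc e) ≡ renE suc (renE ρ e)
renE-ext-weaken ρ e = trans (renE-renE (λ _ → refl) e) (sym (renE-renE (λ _ → refl) e))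

subE-sexts-weaken : ∀ {n m} (σ : SSub n m) e → subE (sexts σ) (renE suc e) ≡ renE suc (subE σ e)
subE-sexts-weaken σ e = trans (subE-renE (λ _ → refl) e) (sym (renE-subE (λ _ → refl) e))

subE-ssingle-weaken : ∀ {n} (v : SVal n) e → subE (ssingle v) (renE suc e) ≡ e
subE-ssingle-weaken v e = trans (subE-renE (λ _ → refl) e) (subE-id (λ _ → refl) e)

mutual
  renC-++C : ∀ {n m} (ρ : Ren n m) c e → renC ρ (c ++C e) ≡ (renC ρ c ++C renE ρ e)
  renC-++C ρ ⟨ v ∣ e′ ⟩ e = cong ⟨ renSV ρ v ∣_⟩ (renE-++E ρ e′ e)

  renE-++E : ∀ {n m} (ρ : Ren n m) e′ e → renE ρ (e′ ++E e) ≡ (renE ρ e′ ++E renE ρ e)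
  renE-++E ρ ε         e = refl
  renE-++E ρ (v ∷ₑ e′) e = cong (renSV ρ v ∷ₑ_) (renE-++E ρ e′ e)
  renE-++E ρ (μ̃ c)     e = cong μ̃ (trans (renC-++C (ext ρ) c (renE suc e))
                                         (cong (renC (ext ρ) c ++C_) (renE-ext-weaken ρ e)))

mutual
  subC-++C : ∀ {n m} (σ : SSub n m) c e → subC σ (c ++C e) ≡ (subC σ c ++C subE σ e)
  subC-++C σ ⟨ v ∣ e′ ⟩ e = cong ⟨ subSV σ v ∣_⟩ (subE-++E σ e′ e)

  subE-++E : ∀ {n m} (σ : SSub n m) e′ e → subE σ (e′ ++E e) ≡ (subE σ e′ ++E subE σ e)
  subE-++E σ ε         e = refl
  subE-++E σ (v ∷ₑ e′) e = cong (subSV σ v ∷ₑ_) (subE-++E σ e′ e)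
  subE-++E σ (μ̃ c)     e = cong μ̃ (trans (subC-++C (sexts σ) c (renE suc e))
                                         (cong (subC (sexts σ) c ++C_) (subE-sexts-weaken σ e)))

mutual
  ++C-assoc : ∀ {n} (c : Cmd n) e₁ e₂ → ((c ++C e₁) ++C e₂) ≡ (c ++C (e₁ ++E e₂))
  ++C-assoc ⟨ v ∣ e ⟩ e₁ e₂ = cong ⟨ v ∣_⟩ (++E-assoc e e₁ e₂)

  ++E-assoc : ∀ {n} (e : Env n) e₁ e₂ → ((e ++E e₁) ++E e₂) ≡ (e ++E (e₁ ++E e₂))
  ++E-assoc ε        e₁ e₂ = refl
  ++E-assoc (v ∷ₑ e) e₁ e₂ = cong (v ∷ₑ_) (++E-assoc e e₁ e₂)
  ++E-assoc (μ̃ c)    e₁ e₂ = cong μ̃ (trans (++C-assoc c (renE suc e₁) (renE suc e₂))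
                                            (cong (c ++C_) (sym (renE-++E suc e₁ e₂))))

mutual
  ++C-identityʳ : ∀ {n} (c : Cmd n) → (c ++C ε) ≡ c
  ++C-identityʳ ⟨ v ∣ e ⟩ = cong ⟨ v ∣_⟩ (++E-identityʳ e)

  ++E-identityʳ : ∀ {n} (e : Env n) → (e ++E ε) ≡ e
  ++E-identityʳ ε        = refl
  ++E-identityʳ (v ∷ₑ e) = cong (v ∷ₑ_) (++E-identityʳ e)
  ++E-identityʳ (μ̃ c)    = cong μ̃ (++C-identityʳ c)

mutual
  renSV-• : ∀ {n m} (ρ : Ren n m) v → renSV ρ (v •) ≡ renV ρ v •
  renSV-• ρ (var x) = refl
  renSV-• ρ (lam t) = cong slam (renC-° (ext ρ) t)

  renC-° : ∀ {n m} (ρ : Ren n m) t → renC ρ (t °) ≡ renT ρ t °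
  renC-° ρ (val v)    = cong ⟨_∣ ε ⟩ (renSV-• ρ v)
  renC-° ρ (app t v)  = trans (renC-++C ρ (t °) _)
                              (cong₂ _++C_ (renC-° ρ t) (cong (_∷ₑ ε) (renSV-• ρ v)))
  renC-° ρ (esub t u) = trans (renC-++C ρ (u °) _)
                              (cong₂ _++C_ (renC-° ρ u) (cong μ̃ (renC-° (ext ρ) t)))

mutual
  subSV-• : ∀ {n m} {σ′ : SSub n m} {σ : Sub n m} → σ′ ≗ _• ∘ σ → ∀ v → subSV σ′ (v •) ≡ subV σ v •
  subSV-• h (var x) = h x
  subSV-• h (lam t) = cong slam (subC-° (sexts-• h) t)

  subC-° : ∀ {n m} {σ′ : SSub n m} {σ : Sub n m} → σ′ ≗ _• ∘ σ → ∀ t → subC σ′ (t °) ≡ subT σ t °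
  subC-°           h (val v)    = cong ⟨_∣ ε ⟩ (subSV-• h v)
  subC-° {σ′ = σ′} h (app t v)  = trans (subC-++C σ′ (t °) _)
                                        (cong₂ _++C_ (subC-° h t) (cong (_∷ₑ ε) (subSV-• h v)))
  subC-° {σ′ = σ′} h (esub t u) = trans (subC-++C σ′ (u °) _)
                                        (cong₂ _++C_ (subC-° h u) (cong μ̃ (subC-° (sexts-• h) t)))

  sexts-• : ∀ {n m} {σ′ : SSub n m} {σ : Sub n m} → σ′ ≗ _• ∘ σ → sexts σ′ ≗ _• ∘ exts σ
  sexts-• h zero = refl
  sexts-• {σ = σ} h (suc i) = trans (cong (renSV suc) (h i)) (renSV-• suc (σ i))

°-⟪⟫ : ∀ {n} (t : Term (suc n)) v → (t ⟪ v ⟫) ° ≡ (t °) ⟦ v • ⟧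
°-⟪⟫ t v = sym (subC-° ssingle-• t)
  where
  ssingle-• : ssingle (v •) ≗ _• ∘ single v
  ssingle-• zero    = refl
  ssingle-• (suc i) = refl

renD : ∀ {n m} → Ren n m → DCtx n → DCtx m
renD ρ (dhole v)   = dhole (renSV ρ v)
renD ρ (dcons D v) = dcons (renD ρ D) (renSV ρ v)

renC-plugD : ∀ {n m} (ρ : Ren n m) D e → renC ρ (plugD D e) ≡ plugD (renD ρ D) (renE ρ e)
renC-plugD ρ (dhole v)   e = refl
renC-plugD ρ (dcons D v) e = renC-plugD ρ D (v ∷ₑ e)

plugD-++C : ∀ {n} (D : DCtx n) e′ e → (plugD D e′ ++C e) ≡ plugD D (e′ ++E e)
plugD-++C (dhole v)   e′ e = refl
plugD-++C (dcons D v) e′ e = plugD-++C D (v ∷ₑ e′) e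

plugL° : ∀ {n m} → SCtx n m → Cmd m → Cmd n
plugL° hole      c = c
plugL° (sub L u) c = (u °) ++C μ̃ (plugL° L c)

°-plugL : ∀ {n m} (L : SCtx n m) t → plugL L t ° ≡ plugL° L (t °)
°-plugL hole      t = refl
°-plugL (sub L u) t = cong (λ c → (u °) ++C μ̃ c) (°-plugL L t)

plugL°-++C : ∀ {n m} (L : SCtx n m) c e → (plugL° L c ++C e) ≡ plugL° L (c ++C renE (wkL L) e)
plugL°-++C hole      c e = cong (c ++C_) (sym (renE-id (λ _ → refl) e))
plugL°-++C (sub L u) c e = begin
  ((u °) ++C μ̃ (plugL° L c)) ++C e                     ≡⟨ ++C-assoc (u °) _ e ⟩
  (u °) ++C μ̃ (plugL° L c ++C renE suc e)              ≡⟨ cong (λ c′ → (u °) ++C μ̃ c′) (plugL°-++C L c _) ⟩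
  (u °) ++C μ̃ (plugL° L (c ++C renE (wkL L) (renE suc e)))
    ≡⟨ cong (λ e′ → (u °) ++C μ̃ (plugL° L (c ++C e′))) (renE-renE (λ _ → refl) e) ⟩
  (u °) ++C μ̃ (plugL° L (c ++C renE (wkL (sub L u)) e)) ∎

module Closure (R : ∀ {n} → Cmd n → Cmd n → Set)
  (R-renC : ∀ {n m} (ρ : Ren n m) {c c′ : Cmd n} → R c c′ → R (renC ρ c) (renC ρ c′))
  (R-++C  : ∀ {n} {c c′ : Cmd n} (e : Env n) → R c c′ → R (c ++C e) (c′ ++C e)) where

  CClos-renC : ∀ {n m} (ρ : Ren n m) {c c′ : Cmd n} → CClos R c c′ → CClos R (renC ρ c) (renC ρ c′)
  CClos-renC ρ (cctx-hole r) = cctx-hole (R-renC ρ r)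
  CClos-renC ρ (cctx-μ̃ D s)  = subst₂ (CClos R) (sym (renC-plugD ρ D _)) (sym (renC-plugD ρ D _))
                                       (cctx-μ̃ (renD ρ D) (CClos-renC (ext ρ) s))

  CClos-++C : ∀ {n} {c c′ : Cmd n} (e : Env n) → CClos R c c′ → CClos R (c ++C e) (c′ ++C e)
  CClos-++C e (cctx-hole r) = cctx-hole (R-++C e r)
  CClos-++C e (cctx-μ̃ D s)  = subst₂ (CClos R) (sym (plugD-++C D _ e)) (sym (plugD-++C D _ e))
                                      (cctx-μ̃ D (CClos-++C (renE suc e) s))

  mutual
    CClos-plugD-++E-μ̃ : ∀ {n} (D : DCtx n) (e : Env n) {c c′ : Cmd (suc n)} → CClos R c c′ →
                         CClos R (plugD D (e ++E μ̃ c)) (plugD D (e ++E μ̃ c′))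
    CClos-plugD-++E-μ̃ D ε        s = cctx-μ̃ D s
    CClos-plugD-++E-μ̃ D (v ∷ₑ e) s = CClos-plugD-++E-μ̃ (dcons D v) e s
    CClos-plugD-++E-μ̃ D (μ̃ c)    s = cctx-μ̃ D (CClos-++C-μ̃ c (CClos-renC (ext suc) s))

    CClos-++C-μ̃ : ∀ {n} (c : Cmd n) {d d′ : Cmd (suc n)} → CClos R d d′ →
                   CClos R (c ++C μ̃ d) (c ++C μ̃ d′)
    CClos-++C-μ̃ ⟨ v ∣ e ⟩ s = CClos-plugD-++E-μ̃ (dhole v) e s

  CClos-plugL° : ∀ {n m} (L : SCtx n m) {c c′ : Cmd m} → CClos R c c′ →
                 CClos R (plugL° L c) (plugL° L c′)
  CClos-plugL° hole      s = s
  CClos-plugL° (sub L u) s = CClos-++C-μ̃ (u °) (CClos-plugL° L s)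

  simulation : {S : ∀ {n} → Term n → Term n → Set} →
               (∀ {n} {t u : Term n} → S t u → CClos R (t °) (u °)) →
               ∀ {n} {t u : Term n} → EClos S t u → CClos R (t °) (u °)
  simulation root (ctx-hole r)  = root r
  simulation root (ctx-app v s) = CClos-++C _ (simulation root s)
  simulation root (ctx-esL u s) = CClos-++C-μ̃ (u °) (simulation root s)
  simulation root (ctx-esR t s) = CClos-++C _ (simulation root s)

↦λ̄-renC : ∀ {n m} (ρ : Ren n m) {c c′ : Cmd n} → c ↦λ̄ c′ → renC ρ c ↦λ̄ renC ρ c′
↦λ̄-renC ρ (root-λ̄ c v e) =
  subst₂ _↦λ̄_ refl (cong ⟨ renSV ρ v ∣_⟩ (sym (renE-++E ρ (μ̃ c) e))) (root-λ̄ _ _ _)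

↦λ̄-++C : ∀ {n} {c c′ : Cmd n} (e : Env n) → c ↦λ̄ c′ → (c ++C e) ↦λ̄ (c′ ++C e)
↦λ̄-++C e (root-λ̄ c v e′) =
  subst₂ _↦λ̄_ refl (cong ⟨ v ∣_⟩ (sym (++E-assoc (μ̃ c) e′ e))) (root-λ̄ _ _ _)

↦μ̃-renC : ∀ {n m} (ρ : Ren n m) {c c′ : Cmd n} → c ↦μ̃ c′ → renC ρ c ↦μ̃ renC ρ c′
↦μ̃-renC ρ (root-μ̃ v c) =
  subst₂ _↦μ̃_ refl (trans (subC-renC (λ _ → refl) c) (sym (renC-subC ren-ssingle c))) (root-μ̃ _ _)
  where
  ren-ssingle : renSV ρ ∘ ssingle v ≗ ssingle (renSV ρ v) ∘ ext ρ
  ren-ssingle zero    = refl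
  ren-ssingle (suc i) = refl

↦μ̃-++C : ∀ {n} {c c′ : Cmd n} (e : Env n) → c ↦μ̃ c′ → (c ++C e) ↦μ̃ (c′ ++C e)
↦μ̃-++C e (root-μ̃ v c) =
  subst₂ _↦μ̃_ refl (trans (subC-++C (ssingle v) c (renE suc e))
                           (cong (c ⟦ v ⟧ ++C_) (subE-ssingle-weaken v e)))
               (root-μ̃ _ _)

module Λ̄ = Closure _↦λ̄_ ↦λ̄-renC ↦λ̄-++C
module M̃ = Closure _↦μ̃_ ↦μ̃-renC ↦μ̃-++C

°-↦m : ∀ {n} {t u : Term n} → t ↦m u → (t °) →λ̄ (u °)
°-↦m (root-m L t v) = subst₂ _→λ̄_ (sym redex) (sym reduct) (Λ̄.CClos-plugL° L (cctx-hole β))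
  where
  v′ = renSV (wkL L) (v •)

  β : ⟨ slam (t °) ∣ v′ ∷ₑ ε ⟩ ↦λ̄ ⟨ v′ ∣ μ̃ (t °) ⟩
  β = subst₂ _↦λ̄_ refl (cong (λ c → ⟨ v′ ∣ μ̃ c ⟩) (++C-identityʳ (t °))) (root-λ̄ (t °) v′ ε)

  redex : app (plugL L (val (lam t))) v ° ≡ plugL° L ⟨ slam (t °) ∣ v′ ∷ₑ ε ⟩
  redex = begin
    plugL L (val (lam t)) ° ++C (v • ∷ₑ ε)     ≡⟨ cong (_++C (v • ∷ₑ ε)) (°-plugL L _) ⟩
    plugL° L ⟨ slam (t °) ∣ ε ⟩ ++C (v • ∷ₑ ε) ≡⟨ plugL°-++C L _ _ ⟩
    plugL° L ⟨ slam (t °) ∣ v′ ∷ₑ ε ⟩          ∎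

  reduct : plugL L (esub t (val (renV (wkL L) v))) ° ≡ plugL° L ⟨ v′ ∣ μ̃ (t °) ⟩
  reduct = begin
    plugL L (esub t (val (renV (wkL L) v))) ° ≡⟨ °-plugL L _ ⟩
    plugL° L ⟨ renV (wkL L) v • ∣ μ̃ (t °) ⟩   ≡⟨ cong (λ w → plugL° L ⟨ w ∣ μ̃ (t °) ⟩) (renSV-• (wkL L) v) ⟨
    plugL° L ⟨ v′ ∣ μ̃ (t °) ⟩                 ∎

°-↦e : ∀ {n} {t u : Term n} → t ↦e u → (t °) →μ̃ (u °)
°-↦e (root-e L t v) =
  subst₂ _→μ̃_ (sym redex) (sym reduct) (M̃.CClos-plugL° L (cctx-hole (root-μ̃ (v •) t′)))
  where
  t′ = renT (ext (wkL L)) t °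

  redex : esub t (plugL L (val v)) ° ≡ plugL° L ⟨ v • ∣ μ̃ t′ ⟩
  redex = begin
    plugL L (val v) ° ++C μ̃ (t °)        ≡⟨ cong (_++C μ̃ (t °)) (°-plugL L _) ⟩
    plugL° L ⟨ v • ∣ ε ⟩ ++C μ̃ (t °)     ≡⟨ plugL°-++C L _ _ ⟩
    plugL° L ⟨ v • ∣ μ̃ (renC _ (t °)) ⟩  ≡⟨ cong (λ c → plugL° L ⟨ v • ∣ μ̃ c ⟩) (renC-° _ t) ⟩
    plugL° L ⟨ v • ∣ μ̃ t′ ⟩              ∎

  reduct : plugL L (renT (ext (wkL L)) t ⟪ v ⟫) ° ≡ plugL° L (t′ ⟦ v • ⟧)
  reduct = trans (°-plugL L _) (cong (plugL° L) (°-⟪⟫ (renT (ext (wkL L)) t) v))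

lemma9 : (∀ {n} {t u : Term n} → t →m u → (t °) →λ̄ (u °))
       × (∀ {n} {t u : Term n} → t →e u → (t °) →μ̃ (u °))
lemma9 = Λ̄.simulation °-↦m , M̃.simulation °-↦e
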